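{- Let $a,b$ be integers with $a>1$ and $b>1$, and let $(e(n))_{n\ge 0}$ be defined by $e(0)=0$, $e(1)=1$, $e(n)=a\,e(n-1)+b\,e(n-2)$ for $n\ge 2$. Then there do not exist real numbers $f,g,h$ such that $$f\,e(i+1)^{2}+g\,e(i+1)\,e(i)+h\,e(i)^{2}=(-1)^{i}$$ for every positive integer $i$. -}

module Defs where

open import Level using (Level)
open import Data.Nat using (ℕ; zero; suc)
open import Data.Integer using (ℤ; +_; -[1+_])
import Data.Integer as Z
open import Relation.Binary.PropositionalEquality using (_≡_)
open import Algebra.Bundles using (CommutativeRing)

e : ℤ → ℤ → ℕ → ℤ
e a b zero = + 0
e a b (suc zero) = + 1
e a b (suc (suc n)) = a Z.* e a b (suc n) Z.+ b Z.* e a b n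

module _ {c ℓ : Level} (R : CommutativeRing c ℓ) where
  open CommutativeRing R renaming (Carrier to A)

  natR : ℕ → A
  natR zero = 0#
  natR (suc n) = 1# + natR n

  intR : ℤ → A
  intR (+ n) = natR n
  intR -[1+ n ] = - natR (suc n)

  powR : A → ℕ → A
  powR x zero = 1#
  powR x (suc n) = x * powR x n

  CharZero : Set ℓ
  CharZero = ∀ m n → natR m ≈ natR n → m ≡ n

-- Write q k = f e(k+1)² + g e(k+1) e(k) + h e(k)².  If α, β are the roots of x² = a x + b,
-- then q k is a combination of (α²)ᵏ, (αβ)ᵏ, (β²)ᵏ, so q obeys the third-order recurrence
-- with characteristic polynomial (x - α²)(x - αβ)(x - β²) = x³ - S x² - b S x + b³,
-- S = a² + b.  Feeding q k = (-1)ᵏ (k ≥ 1) into it gives 1 + S = b S + b³, which in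
-- characteristic zero is an identity of naturals, false as soon as b ≥ 2.
module Submission where

open import Defs
open import Level using (Level)
open import Data.Nat using (ℕ; zero; suc)
open import Data.Integer using (ℤ; +_; _<_)
open import Data.Product using (Σ; _,_)
open import Relation.Nullary using (¬_)
open import Algebra.Bundles using (CommutativeRing; CommutativeSemiring)
import Data.Nat as ℕ
import Data.Nat.Properties as ℕ
import Data.Integer as ℤ
import Data.Integer.Properties as ℤ
open import Relation.Binary.PropositionalEquality as ≡ using (_≡_; module ≡-Reasoning)
import Algebra.Properties.Ring as RingProperties
import Algebra.Properties.Semiring.Mult as SemiringMult
import Algebra.Solver.Ring.NaturalCoefficients.Default as SemiringSolver
import Relation.Binary.Reasoning.Setoid as SetoidReasoning

eℕ : ℕ → ℕ → ℕ → ℕ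
eℕ a b zero = 0
eℕ a b (suc zero) = 1
eℕ a b (suc (suc n)) = a ℕ.* eℕ a b (suc n) ℕ.+ b ℕ.* eℕ a b n

e-+ : ∀ a b k → e (+ a) (+ b) k ≡ + eℕ a b k
e-+ a b zero = ≡.refl
e-+ a b (suc zero) = ≡.refl
e-+ a b (suc (suc n)) = begin
  + a ℤ.* e (+ a) (+ b) (suc n) ℤ.+ + b ℤ.* e (+ a) (+ b) n
    ≡⟨ ≡.cong₂ (λ x y → + a ℤ.* x ℤ.+ + b ℤ.* y) (e-+ a b (suc n)) (e-+ a b n) ⟩
  + a ℤ.* + eℕ a b (suc n) ℤ.+ + b ℤ.* + eℕ a b n
    ≡⟨ ≡.cong₂ ℤ._+_ (≡.sym (ℤ.pos-* a _)) (≡.sym (ℤ.pos-* b _)) ⟩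
  + (a ℕ.* eℕ a b (suc n)) ℤ.+ + (b ℕ.* eℕ a b n)
    ≡⟨ ≡.sym (ℤ.pos-+ (a ℕ.* eℕ a b (suc n)) (b ℕ.* eℕ a b n)) ⟩
  + eℕ a b (suc (suc n)) ∎
  where open ≡-Reasoning

1+S<b*S+b³ : ∀ a b → 2 ℕ.≤ b →
             let S = a ℕ.* a ℕ.+ b in 1 ℕ.+ S ℕ.< b ℕ.* S ℕ.+ b ℕ.* b ℕ.* b
1+S<b*S+b³ a b 2≤b = begin-strict
  1 ℕ.+ S                     <⟨ ℕ.n<1+n (1 ℕ.+ S) ⟩
  2 ℕ.+ S                     ≤⟨ ℕ.+-monoˡ-≤ S (ℕ.≤-trans 2≤b (ℕ.m≤n+m b (a ℕ.* a))) ⟩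
  S ℕ.+ S                     ≡⟨ ≡.cong (S ℕ.+_) (≡.sym (ℕ.+-identityʳ S)) ⟩
  2 ℕ.* S                     ≤⟨ ℕ.*-monoˡ-≤ S 2≤b ⟩
  b ℕ.* S                     ≤⟨ ℕ.m≤m+n (b ℕ.* S) (b ℕ.* b ℕ.* b) ⟩
  b ℕ.* S ℕ.+ b ℕ.* b ℕ.* b   ∎
  where
  S = a ℕ.* a ℕ.+ b
  open ℕ.≤-Reasoning

module QuadraticForm {c ℓ : Level} (R : CommutativeSemiring c ℓ) where
  open CommutativeSemiring R
  open SemiringSolver R using (solve; _:+_; _:*_; _:=_)

  quadForm : Carrier → Carrier → Carrier → Carrier → Carrier → Carrier
  quadForm f g h x y = f * (x * x) + g * (x * y) + h * (y * y)

  quadForm-cong : ∀ f g h {x x′ y y′} → x ≈ x′ → y ≈ y′ → quadForm f g h x y ≈ quadForm f g h x′ y′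
  quadForm-cong f g h x≈x′ y≈y′ =
    +-cong (+-cong (*-congˡ (*-cong x≈x′ x≈x′)) (*-congˡ (*-cong x≈x′ y≈y′))) (*-congˡ (*-cong y≈y′ y≈y′))

  quadForm-three-steps : ∀ A B f g h x y →
    let x₂ = A * x + B * y
        x₃ = A * x₂ + B * x
        x₄ = A * x₃ + B * x₂
        S = A * A + B
    in quadForm f g h x₄ x₃ + B * B * B * quadForm f g h x y
       ≈ S * quadForm f g h x₃ x₂ + B * S * quadForm f g h x₂ x
  quadForm-three-steps = solve 7 (λ A B f g h x y →
    let Q = λ u v → f :* (u :* u) :+ g :* (u :* v) :+ h :* (v :* v)
        x₂ = A :* x :+ B :* y
        x₃ = A :* x₂ :+ B :* x
        x₄ = A :* x₃ :+ B :* x₂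
        S = A :* A :+ B
    in Q x₄ x₃ :+ B :* B :* B :* Q x y := S :* Q x₃ x₂ :+ B :* S :* Q x₂ x) refl

  module _ (A B : Carrier) (u : ℕ → Carrier) (u-rec : ∀ k → u (suc (suc k)) ≈ A * u (suc k) + B * u k) where

    quadForm-recurrence : ∀ f g h k →
      let q = λ j → quadForm f g h (u (suc j)) (u j)
          S = A * A + B
      in q (3 ℕ.+ k) + B * B * B * q k ≈ S * q (2 ℕ.+ k) + B * S * q (1 ℕ.+ k)
    quadForm-recurrence f g h k = begin
      Q (u (4 ℕ.+ k)) (u (3 ℕ.+ k)) + B * B * B * Q x y
        ≈⟨ +-congʳ (quadForm-cong f g h u₄≈ u₃≈) ⟩
      Q x₄ x₃ + B * B * B * Q x y
        ≈⟨ quadForm-three-steps A B f g h x y ⟩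
      S * Q x₃ x₂ + B * S * Q x₂ x
        ≈⟨ +-cong (*-congˡ (quadForm-cong f g h u₃≈ u₂≈)) (*-congˡ (quadForm-cong f g h u₂≈ refl)) ⟨
      S * Q (u (3 ℕ.+ k)) (u (2 ℕ.+ k)) + B * S * Q (u (2 ℕ.+ k)) x ∎
      where
      open SetoidReasoning setoid
      Q = quadForm f g h
      S = A * A + B
      x = u (1 ℕ.+ k)
      y = u k
      x₂ = A * x + B * y
      x₃ = A * x₂ + B * x
      x₄ = A * x₃ + B * x₂
      u₂≈ : u (2 ℕ.+ k) ≈ x₂
      u₂≈ = u-rec k
      u₃≈ : u (3 ℕ.+ k) ≈ x₃
      u₃≈ = trans (u-rec (1 ℕ.+ k)) (+-congʳ (*-congˡ u₂≈))
      u₄≈ : u (4 ℕ.+ k) ≈ x₄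
      u₄≈ = trans (u-rec (2 ℕ.+ k)) (+-cong (*-congˡ u₃≈) (*-congˡ u₂≈))

module _ {c ℓ : Level} (R : CommutativeRing c ℓ) where
  open CommutativeRing R
  open SemiringMult semiring using (_×_; ×-homo-+; ×1-homo-*)
  open RingProperties ring using (-1*x≈-x; -‿involutive)
  open SemiringSolver commutativeSemiring using (solve; _:+_; _:*_; _:=_; con)

  natR≡×1# : ∀ n → natR R n ≡ n × 1#
  natR≡×1# zero = ≡.refl
  natR≡×1# (suc n) = ≡.cong (_+_ 1#) (natR≡×1# n)

  natR-+ : ∀ m n → natR R (m ℕ.+ n) ≈ natR R m + natR R n
  natR-+ m n rewrite natR≡×1# (m ℕ.+ n) | natR≡×1# m | natR≡×1# n = ×-homo-+ 1# m n

  natR-* : ∀ m n → natR R (m ℕ.* n) ≈ natR R m * natR R n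
  natR-* m n rewrite natR≡×1# (m ℕ.* n) | natR≡×1# m | natR≡×1# n = ×1-homo-* m n

  natR-eℕ-rec : ∀ a b k →
    natR R (eℕ a b (suc (suc k))) ≈ natR R a * natR R (eℕ a b (suc k)) + natR R b * natR R (eℕ a b k)
  natR-eℕ-rec a b k =
    trans (natR-+ (a ℕ.* eℕ a b (suc k)) (b ℕ.* eℕ a b k)) (+-cong (natR-* a _) (natR-* b _))

  -1^2+n≈-1^n : ∀ n → powR R (- 1#) (2 ℕ.+ n) ≈ powR R (- 1#) n
  -1^2+n≈-1^n n = trans (-1*x≈-x _) (trans (-‿cong (-1*x≈-x _)) (-‿involutive _))

  open QuadraticForm commutativeSemiring using (quadForm; quadForm-cong; quadForm-recurrence)

  transpose-by-negation : ∀ {x y z w} → x + y * - 1# ≈ z * - 1# + w → x + z ≈ w + y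
  transpose-by-negation {x} {y} {z} {w} eq = begin
    x + z                   ≈⟨ absorb y ⟨
    x + z + y * (t + 1#)    ≈⟨ regroupˡ x y z t ⟩
    (x + y * t) + (z + y)   ≈⟨ +-congʳ eq ⟩
    (z * t + w) + (z + y)   ≈⟨ regroupʳ w y z t ⟩
    w + y + z * (t + 1#)    ≈⟨ absorb z ⟩
    w + y                   ∎
    where
    open SetoidReasoning setoid
    t = - 1#
    absorb : ∀ {v} s → v + s * (t + 1#) ≈ v
    absorb s = trans (+-congˡ (trans (*-congˡ (-‿inverseˡ 1#)) (zeroʳ s))) (+-identityʳ _)
    regroupˡ : ∀ x y z t → x + z + y * (t + 1#) ≈ (x + y * t) + (z + y)
    regroupˡ = solve 4 (λ x y z t → x :+ z :+ y :* (t :+ con 1) := (x :+ y :* t) :+ (z :+ y)) refl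
    regroupʳ : ∀ w y z t → (z * t + w) + (z + y) ≈ w + y + z * (t + 1#)
    regroupʳ = solve 4 (λ w y z t → (z :* t :+ w) :+ (z :+ y) := w :+ y :+ z :* (t :+ con 1)) refl

  alternating-quadForm⇒ : ∀ A B (u : ℕ → Carrier) → (∀ k → u (suc (suc k)) ≈ A * u (suc k) + B * u k) →
    ∀ f g h → (∀ i → quadForm f g h (u (suc (suc i))) (u (suc i)) ≈ powR R (- 1#) (suc i)) →
    1# + (A * A + B) ≈ B * (A * A + B) + B * B * B
  alternating-quadForm⇒ A B u u-rec f g h alt =
    transpose-by-negation (begin
      1# + B * B * B * - 1#       ≈⟨ +-cong q₃≈1 (*-congˡ q₀≈-1) ⟨
      q 3 + B * B * B * q 0       ≈⟨ quadForm-recurrence A B u u-rec f g h 1 ⟩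
      S * q 2 + B * S * q 1       ≈⟨ +-cong (*-congˡ q₂≈-1) (trans (*-congˡ q₁≈1) (*-identityʳ _)) ⟩
      S * - 1# + B * S            ∎)
    where
    open SetoidReasoning setoid
    S = A * A + B
    q : ℕ → Carrier
    q i = quadForm f g h (u (suc (suc i))) (u (suc i))
    q₀≈-1 : q 0 ≈ - 1#
    q₀≈-1 = trans (alt 0) (*-identityʳ _)
    q₁≈1 : q 1 ≈ 1#
    q₁≈1 = trans (alt 1) (-1^2+n≈-1^n 0)
    q₂≈-1 : q 2 ≈ - 1#
    q₂≈-1 = trans (alt 2) (trans (-1^2+n≈-1^n 1) (*-identityʳ _))
    q₃≈1 : q 3 ≈ 1#
    q₃≈1 = trans (alt 3) (trans (-1^2+n≈-1^n 2) (-1^2+n≈-1^n 0))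

lemma12 : ∀ {c ℓ : Level} (R : CommutativeRing c ℓ) → CharZero R →
          (a b : ℤ) → + 1 < a → + 1 < b →
          ¬ (Σ (CommutativeRing.Carrier R) λ f → Σ (CommutativeRing.Carrier R) λ g → Σ (CommutativeRing.Carrier R) λ h →
               ∀ (i : ℕ) →
               let open CommutativeRing R
                   E = λ k → intR R (e a b k)
               in f * (E (suc (suc i)) * E (suc (suc i))) + g * (E (suc (suc i)) * E (suc i)) + h * (E (suc i) * E (suc i))
                  ≈ powR R (- 1#) (suc i))
-- The hypothesis a > 1 only serves to make a non-negative; the argument needs b ≥ 2 alone.
lemma12 R charZero (+ a) (+ b) (ℤ.+<+ _) (ℤ.+<+ 2≤b) (f , g , h , alt) =
  ℕ.<⇒≢ (1+S<b*S+b³ a b 2≤b) (charZero _ _ (begin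
    1# + natR R Sℕ                              ≈⟨ +-congˡ natR-S ⟩
    1# + S                                      ≈⟨ alternating-quadForm⇒ R A B u (natR-eℕ-rec R a b) f g h altᵤ ⟩
    B * S + B * B * B                           ≈⟨ +-cong natR-bS natR-b³ ⟨
    natR R (b ℕ.* Sℕ) + natR R (b ℕ.* b ℕ.* b)  ≈⟨ natR-+ R (b ℕ.* Sℕ) (b ℕ.* b ℕ.* b) ⟨
    natR R (b ℕ.* Sℕ ℕ.+ b ℕ.* b ℕ.* b)         ∎))
  where
  open CommutativeRing R
  open QuadraticForm commutativeSemiring using (quadForm; quadForm-cong)
  open SetoidReasoning setoid
  A = natR R a
  B = natR R b
  S = A * A + B
  Sℕ = a ℕ.* a ℕ.+ b
  u : ℕ → Carrier
  u k = natR R (eℕ a b k)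
  natR-S : natR R Sℕ ≈ S
  natR-S = trans (natR-+ R (a ℕ.* a) b) (+-congʳ (natR-* R a a))
  natR-bS : natR R (b ℕ.* Sℕ) ≈ B * S
  natR-bS = trans (natR-* R b Sℕ) (*-congˡ natR-S)
  natR-b³ : natR R (b ℕ.* b ℕ.* b) ≈ B * B * B
  natR-b³ = trans (natR-* R (b ℕ.* b) b) (*-congʳ (natR-* R b b))
  u≈E : ∀ k → u k ≈ intR R (e (+ a) (+ b) k)
  u≈E k = reflexive (≡.sym (≡.cong (intR R) (e-+ a b k)))
  altᵤ : ∀ i → quadForm f g h (u (suc (suc i))) (u (suc i)) ≈ powR R (- 1#) (suc i)
  altᵤ i = trans (quadForm-cong f g h (u≈E (suc (suc i))) (u≈E (suc i))) (alt i)
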